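{- Let $(t,r)$ be a standard pair of shape $(\mu,\nu)$, i.e. a maximal chain $(0,0)=\pi_0\subseteq\cdots\subseteq\pi_N=(\mu,\nu)$ in the double Young lattice, and let its image under $*$ be the standard pair given by the chain $\pi_0^*\subseteq\cdots\subseteq\pi_N^*$. Then $(t,r)$ is a fixed point of $*$ (i.e. $\pi_m^*=\pi_m$ for all $m$) if and only if $(\mu,\nu)$ is a fixed point of $*$ (equivalently $\nu_1\ge\mu_1\ge\nu_2\ge\mu_2\ge\cdots$) and the filling $T$ of the diagram of shape $(\nu_1,\mu_1,\nu_2,\mu_2,\dots)$ whose row $2k-1$ is the $k$-th row of $r$ and whose row $2k$ is the $k$-th row of $t$ (rows numbered from the bottom) is a standard tableau.
   Context: Partitions are weakly decreasing sequences of nonnegative integers, identified up to trailing zeros; diagrams use French convention (row 1 at the bottom). For partitions $\mu,\nu$ written as $n$-tuples, the $*$-operation is $(\mu,\nu)^*=(\lambda(\mu,\nu),\rho(\mu,\nu))$ with $\lambda_k=\mu_k-k+\#\{j\in\{1,\dots,n\}: \nu_j-j\ge \mu_k-k\}$ and $\rho_j=\nu_j-j+1+\#\{k\in\{1,\dots,n\}:\mu_k-k>\nu_j-j\}$. The double Young lattice is the set of pairs of partitions ordered componentwise by diagram inclusion. A standard pair of shape $(\mu,\nu)$ is a maximal chain from $(0,0)$ to $(\mu,\nu)$; it is identified with a pair $(t,r)$ of fillings of the diagrams of $\mu$ and $\nu$, where the cell added at step $m$ receives the entry $m$, so the entries $1,\dots,|\mu|+|\nu|$ each occur once and $t,r$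 are standard (entries increase along rows from left to right and up columns). The $*$-image of a standard pair is obtained by applying $*$ to every element of the chain (this is again a standard pair). A standard tableau here is a filling with distinct entries increasing along rows left to right and along columns bottom to top. -}

module Defs where

open import Data.Nat using (ℕ; zero; suc; _≤_; _<_; _∸_) renaming (_+_ to _+ℕ_; _*_ to _*ℕ_)
open import Data.Fin using (Fin; toℕ)
open import Data.Integer using (ℤ; +_; _+_; _-_; _≤?_; _<?_)
open import Data.List using (List; length; filter; allFin)
open import Data.Product using (Σ; ∃; _×_; _,_; proj₁; proj₂)
open import Data.Sum using (_⊎_)
open import Relation.Unary using (Pred; Decidable)
open import Level using () renaming (zero to lzero)
open import Relation.Binary.PropositionalEquality using (_≡_; _≢_)

-- Partitions as n-tuples (entry k : Fin n is the part μ_{k+1}).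

Tuple : ℕ → Set
Tuple n = Fin n → ℕ

IsPartition : ∀ {n} → Tuple n → Set
IsPartition {n} p = ∀ (i j : Fin n) → toℕ i ≤ toℕ j → p j ≤ p i

Pair : ℕ → Set
Pair n = Tuple n × Tuple n

count : ∀ {n} {P : Pred (Fin n) lzero} → Decidable P → ℕ
count {n} d = length (filter d (allFin n))

-- μ_k - k  (with the paper's 1-based index k = toℕ i + 1), as an integer
shifted : ∀ {n} → Tuple n → Fin n → ℤ
shifted p i = + p i - + (toℕ i +ℕ 1)

starλ : ∀ {n} → Tuple n → Tuple n → Fin n → ℤ
starλ μ ν k = shifted μ k + + count (λ j → shifted μ k ≤? shifted ν j)

starρ : ∀ {n} → Tuple n → Tuple n → Fin n → ℤ
starρ μ ν j = shifted ν j + + 1 + + count (λ k → shifted ν j <? shifted μ k)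

StarFixed : ∀ {n} → Pair n → Set
StarFixed {n} (μ , ν) =
  (∀ (k : Fin n) → starλ μ ν k ≡ + μ k) × (∀ (j : Fin n) → starρ μ ν j ≡ + ν j)

AddCell : ∀ {n} → Tuple n → Tuple n → Set
AddCell {n} p q = Σ (Fin n) λ i → (q i ≡ suc (p i)) × (∀ j → j ≢ i → q j ≡ p j)

SameTuple : ∀ {n} → Tuple n → Tuple n → Set
SameTuple p q = ∀ j → q j ≡ p j

Cover : ∀ {n} → Pair n → Pair n → Set
Cover (μ , ν) (μ' , ν') =
  (AddCell μ μ' × SameTuple ν ν') ⊎ (SameTuple μ μ' × AddCell ν ν')

record StandardPair (n : ℕ) (μ ν : Tuple n) (N : ℕ) (π : ℕ → Pair n) : Set where
  field
    start      : SameTuple (λ _ → 0) (proj₁ (π 0)) × SameTuple (λ _ → 0) (proj₂ (π 0))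
    end        : SameTuple μ (proj₁ (π N)) × SameTuple ν (proj₂ (π N))
    partitions : ∀ m → m ≤ N → IsPartition (proj₁ (π m)) × IsPartition (proj₂ (π m))
    covers     : ∀ m → m < N → Cover (π m) (π (suc m))

-- The fillings t and r of a standard pair: the cell in row k (: Fin n),
-- column c (0-based, c < length of row) receives the entry m iff it is
-- added at step m, i.e. lies in π_m but not in π_{m-1}.

tEntry : ∀ {n} → (ℕ → Pair n) → ℕ → Fin n → ℕ → ℕ → Set
tEntry π N k c m = (1 ≤ m) × (m ≤ N) × (c < proj₁ (π m) k) × (proj₁ (π (m ∸ 1)) k ≤ c)

rEntry : ∀ {n} → (ℕ → Pair n) → ℕ → Fin n → ℕ → ℕ → Set
rEntry π N k c m = (1 ≤ m) × (m ≤ N) × (c < proj₂ (π m) k) × (proj₂ (π (m ∸ 1)) k ≤ c)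

-- Rows are indexed by ℕ (row 0 is the
-- bottom row), columns by ℕ (column 0 is leftmost).  A filling is given
-- by its diagram (InShape row col) and its entries (Entry row col value).

record Filling : Set₁ where
  field
    InShape : ℕ → ℕ → Set
    Entry   : ℕ → ℕ → ℕ → Set

record StandardTableau (T : Filling) : Set where
  open Filling T
  field
    distinct : ∀ a c a' c' m → Entry a c m → Entry a' c' m → (a ≡ a') × (c ≡ c')
    rowInc   : ∀ a c c' m m' → c < c' → InShape a c → InShape a c' →
               Entry a c m → Entry a c' m' → m < m'
    colInc   : ∀ a c m m' → InShape a c → InShape (suc a) c →
               Entry a c m → Entry (suc a) c m' → m < m'

tableauT : ∀ {n} → Tuple n → Tuple n → (ℕ → Pair n) → ℕ → Filling
tableauT {n} μ ν π N = record
  { InShape = λ a c → Σ (Fin n) λ i →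
        ((a ≡ 2 *ℕ toℕ i) × (c < ν i)) ⊎ ((a ≡ 2 *ℕ toℕ i +ℕ 1) × (c < μ i))
  ; Entry = λ a c m → Σ (Fin n) λ i →
        ((a ≡ 2 *ℕ toℕ i) × rEntry π N i c m) ⊎ ((a ≡ 2 *ℕ toℕ i +ℕ 1) × tEntry π N i c m)
  }

-- A pair (μ , ν) of partitions is *-fixed exactly when it interlaces,
-- ν₁ ≥ μ₁ ≥ ν₂ ≥ μ₂ ≥ ⋯: interlacing makes the sequences μₖ − k and νⱼ − j
-- alternate, so the counts in λₖ and ρⱼ are k and j − 1, and conversely a
-- violated inequality makes one of these counts too small.  A maximal chain
-- fills the interleaved diagram T cell by cell, so rows of T always increase
-- and entries are distinct, and the cells of T filled by step m are exactly
-- π_m.  Columns of T increase iff each π_m is closed downwards in T, i.e.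
-- iff every π_m interlaces.
module Submission where

open import Defs
open import Data.Nat
  using (ℕ; zero; suc; _+_; _*_; _∸_; _≤_; _<_; _≮_; _<?_; z≤n; s≤s; _≤′_; ≤′-refl; ≤′-step)
open import Data.Nat.Properties
open import Data.Fin as Fin using (Fin; toℕ; fromℕ<)
open import Data.Fin.Properties using (toℕ-injective; toℕ<n; toℕ-fromℕ<)
open import Data.Integer as ℤ using (ℤ; +_; 1ℤ)
import Data.Integer.Properties as ℤ
open import Data.Integer.Tactic.RingSolver using (solve-∀)
open import Data.List using (length; filter; tabulate)
open import Data.List.Properties using (filter-accept)
open import Data.Product using (_×_; _,_; Σ; proj₁; proj₂)
open import Data.Sum using (inj₁; inj₂)
open import Data.Empty using (⊥-elim)
open import Function using (_∘_; id)
open import Function.Bundles using (_⇔_; mk⇔; Equivalence)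
open import Function.Properties.Equivalence using () renaming (trans to ⇔-trans)
open import Level using () renaming (zero to lzero)
open import Relation.Nullary using (yes; no)
open import Relation.Unary using (Pred; Decidable)
open import Relation.Binary.PropositionalEquality

open Equivalence using (to; from)

[x-y]+z≡x⇔z≡y : ∀ (x y z : ℤ) → x ℤ.- y ℤ.+ z ≡ x ⇔ z ≡ y
[x-y]+z≡x⇔z≡y x y z = mk⇔
  (λ eq → begin
     z                             ≡⟨ cancel x y z ⟩
     (x ℤ.- y ℤ.+ z) ℤ.- (x ℤ.- y) ≡⟨ cong (ℤ._- (x ℤ.- y)) eq ⟩
     x ℤ.- (x ℤ.- y)               ≡⟨ sub-sub x y ⟩
     y                             ∎)
  (λ { refl → sub-add x y })
  where
  open ≡-Reasoning
  cancel : ∀ (x y z : ℤ) → z ≡ (x ℤ.- y ℤ.+ z) ℤ.- (x ℤ.- y)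
  cancel = solve-∀
  sub-sub : ∀ (x y : ℤ) → x ℤ.- (x ℤ.- y) ≡ y
  sub-sub = solve-∀
  sub-add : ∀ (x y : ℤ) → x ℤ.- y ℤ.+ y ≡ x
  sub-add = solve-∀

x-y≤z-w⇔x+w≤z+y : ∀ (x y z w : ℤ) → x ℤ.- y ℤ.≤ z ℤ.- w ⇔ x ℤ.+ w ℤ.≤ z ℤ.+ y
x-y≤z-w⇔x+w≤z+y x y z w = mk⇔
  (λ h → subst₂ ℤ._≤_ (left x y w) (right z w y) (ℤ.+-monoˡ-≤ (y ℤ.+ w) h))
  (λ h → subst₂ ℤ._≤_ (left′ x w y) (right′ z y w) (ℤ.+-monoˡ-≤ (ℤ.- (y ℤ.+ w)) h))
  where
  left : ∀ (a b c : ℤ) → a ℤ.- b ℤ.+ (b ℤ.+ c) ≡ a ℤ.+ c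
  left = solve-∀
  right : ∀ (a b c : ℤ) → a ℤ.- b ℤ.+ (c ℤ.+ b) ≡ a ℤ.+ c
  right = solve-∀
  left′ : ∀ (a b c : ℤ) → a ℤ.+ b ℤ.- (c ℤ.+ b) ≡ a ℤ.- c
  left′ = solve-∀
  right′ : ∀ (a b c : ℤ) → a ℤ.+ b ℤ.- (b ℤ.+ c) ≡ a ℤ.- c
  right′ = solve-∀

shifted-≤⇔ : ∀ {n} (p q : Tuple n) i j →
             shifted p i ℤ.≤ shifted q j ⇔ p i + toℕ j ≤ q j + toℕ i
shifted-≤⇔ p q i j = mk⇔
  (λ h → ≤-pred (ℤ.drop‿+≤+ (subst₂ ℤ._≤_ (plus-suc (p i) (toℕ j)) (plus-suc (q j) (toℕ i))
                                          (to equivalence h))))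
  (λ h → from equivalence
              (subst₂ ℤ._≤_ (sym (plus-suc (p i) (toℕ j))) (sym (plus-suc (q j) (toℕ i)))
                      (ℤ.+≤+ (s≤s h))))
  where
  equivalence : shifted p i ℤ.≤ shifted q j ⇔
                + p i ℤ.+ + (toℕ j + 1) ℤ.≤ + q j ℤ.+ + (toℕ i + 1)
  equivalence = x-y≤z-w⇔x+w≤z+y (+ p i) (+ (toℕ i + 1)) (+ q j) (+ (toℕ j + 1))
  plus-suc : ∀ a b → + a ℤ.+ + (b + 1) ≡ + suc (a + b)
  plus-suc a b = trans (sym (ℤ.pos-+ a (b + 1)))
                       (cong +_ (trans (sym (+-assoc a b 1)) (+-comm (a + b) 1)))

shifted-<⇔ : ∀ {n} (p q : Tuple n) i j →
             shifted q j ℤ.< shifted p i ⇔ q j + toℕ i < p i + toℕ j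
shifted-<⇔ p q i j = mk⇔
  (λ h → ≰⇒> (λ le → ℤ.<⇒≱ h (from (shifted-≤⇔ p q i j) le)))
  (λ h → ℤ.≰⇒> (λ le → <⇒≱ h (to (shifted-≤⇔ p q i j) le)))

starλ≡⇔count≡ : ∀ {n} (μ ν : Tuple n) k →
                starλ μ ν k ≡ + μ k ⇔ count (λ j → shifted μ k ℤ.≤? shifted ν j) ≡ suc (toℕ k)
starλ≡⇔count≡ μ ν k = mk⇔
  (λ eq → trans (ℤ.+-injective (to equation eq)) (+-comm (toℕ k) 1))
  (λ eq → from equation (cong +_ (trans eq (+-comm 1 (toℕ k)))))
  where
  c : ℕ
  c = count (λ j → shifted μ k ℤ.≤? shifted ν j)
  equation : starλ μ ν k ≡ + μ k ⇔ + c ≡ + (toℕ k + 1)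
  equation = [x-y]+z≡x⇔z≡y (+ μ k) (+ (toℕ k + 1)) (+ c)

starρ≡⇔count≡ : ∀ {n} (μ ν : Tuple n) j →
                starρ μ ν j ≡ + ν j ⇔ count (λ k → shifted ν j ℤ.<? shifted μ k) ≡ toℕ j
starρ≡⇔count≡ μ ν j = mk⇔
  (λ eq → ℤ.+-injective (to equation (trans (sym regroup) eq)))
  (λ eq → trans regroup (from equation (cong +_ eq)))
  where
  c : ℕ
  c = count (λ k → shifted ν j ℤ.<? shifted μ k)
  equation : + ν j ℤ.- + toℕ j ℤ.+ + c ≡ + ν j ⇔ + c ≡ + toℕ j
  equation = [x-y]+z≡x⇔z≡y (+ ν j) (+ toℕ j) (+ c)
  normalise : ∀ (x y z : ℤ) → x ℤ.- (y ℤ.+ 1ℤ) ℤ.+ 1ℤ ℤ.+ z ≡ x ℤ.- y ℤ.+ z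
  normalise = solve-∀
  regroup : starρ μ ν j ≡ + ν j ℤ.- + toℕ j ℤ.+ + c
  regroup = trans (cong (λ y → + ν j ℤ.- y ℤ.+ 1ℤ ℤ.+ + c) (ℤ.pos-+ (toℕ j) 1))
                  (normalise (+ ν j) (+ toℕ j) (+ c))

module _ {n} {P : Pred (Fin n) lzero} (P? : Decidable P) where
  private
    filter-tabulate-≤ : ∀ {k} (g : Fin k → Fin n) p → (∀ i → P (g i) → toℕ i < p) →
                        length (filter P? (tabulate g)) ≤ p
    filter-tabulate-≤ {zero} g p below = z≤n
    filter-tabulate-≤ {suc k} g p below with P? (g Fin.zero)
    ... | yes P₀ with below Fin.zero P₀
    ...   | s≤s _ = s≤s (filter-tabulate-≤ (g ∘ Fin.suc) _ (λ i Pi → ≤-pred (below (Fin.suc i) Pi)))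
    filter-tabulate-≤ {suc k} g p below | no _ =
      filter-tabulate-≤ (g ∘ Fin.suc) p (λ i Pi → <-trans (n<1+n _) (below (Fin.suc i) Pi))

    ≤-filter-tabulate : ∀ {k} (g : Fin k → Fin n) p → p ≤ k → (∀ i → toℕ i < p → P (g i)) →
                        p ≤ length (filter P? (tabulate g))
    ≤-filter-tabulate g zero _ _ = z≤n
    ≤-filter-tabulate g (suc p) (s≤s p≤k) above
      rewrite filter-accept P? {xs = tabulate (g ∘ Fin.suc)} (above Fin.zero (s≤s z≤n)) =
      s≤s (≤-filter-tabulate (g ∘ Fin.suc) p p≤k (λ i i<p → above (Fin.suc i) (s≤s i<p)))

  count-≤ : ∀ {p} → (∀ i → P i → toℕ i < p) → count P? ≤ p
  count-≤ = filter-tabulate-≤ id _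

  count-≡ : ∀ {p} → p ≤ n → (∀ i → P i → toℕ i < p) → (∀ i → toℕ i < p → P i) →
            count P? ≡ p
  count-≡ p≤n below above = ≤-antisym (count-≤ below) (≤-filter-tabulate id _ p≤n above)

-- The interleaved diagram T and interlacing pairs

data Side : Set where
  μ-side ν-side : Side

part : ∀ {n} → Side → Pair n → Tuple n
part μ-side = proj₁
part ν-side = proj₂

rowIndex : ∀ {n} → Side → Fin n → ℕ
rowIndex μ-side i = 2 * toℕ i + 1
rowIndex ν-side i = 2 * toℕ i

data RowBelow {n} : Side → Fin n → Side → Fin n → Set where
  ν-below-μ : ∀ {i} → RowBelow ν-side i μ-side i
  μ-below-ν : ∀ {i i'} → toℕ i' ≡ suc (toℕ i) → RowBelow μ-side i ν-side i'

-- ν₁ ≥ μ₁ ≥ ν₂ ≥ μ₂ ≥ ⋯, i.e. the rows of T have the lengths of a partition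
Interlaced : ∀ {n} → Pair n → Set
Interlaced p = ∀ {s i s' i'} → RowBelow s i s' i' → part s' p i' ≤ part s p i

RowBelow⇒≢ : ∀ {n s s'} {i i' : Fin n} → RowBelow s i s' i' → s ≢ s'
RowBelow⇒≢ ν-below-μ ()
RowBelow⇒≢ (μ-below-ν _) ()

suc[2*x+1]≡2*suc[x] : ∀ x → suc (2 * x + 1) ≡ 2 * suc x
suc[2*x+1]≡2*suc[x] x = trans (cong suc (+-comm (2 * x) 1)) (sym (*-suc 2 x))

RowBelow⇒suc-rowIndex : ∀ {n s s'} {i i' : Fin n} → RowBelow s i s' i' →
                        suc (rowIndex s i) ≡ rowIndex s' i'
RowBelow⇒suc-rowIndex {i = i} ν-below-μ = +-comm 1 (2 * toℕ i)
RowBelow⇒suc-rowIndex {i = i} (μ-below-ν eq) =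
  trans (suc[2*x+1]≡2*suc[x] (toℕ i)) (cong (2 *_) (sym eq))

suc-rowIndex⇒RowBelow : ∀ {n s s'} {i i' : Fin n} → suc (rowIndex s i) ≡ rowIndex s' i' →
                        RowBelow s i s' i'
suc-rowIndex⇒RowBelow {s = ν-side} {μ-side} {i} {i'} eq
  with toℕ-injective {i = i} {j = i'}
         (*-cancelˡ-≡ _ _ 2 (suc-injective (trans eq (+-comm (2 * toℕ i') 1))))
... | refl = ν-below-μ
suc-rowIndex⇒RowBelow {s = μ-side} {ν-side} {i} {i'} eq =
  μ-below-ν (sym (*-cancelˡ-≡ _ _ 2 (trans (sym (suc[2*x+1]≡2*suc[x] (toℕ i))) eq)))
suc-rowIndex⇒RowBelow {s = ν-side} {ν-side} {i} {i'} eq = ⊥-elim (even≢odd (toℕ i') (toℕ i) (sym eq))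
suc-rowIndex⇒RowBelow {s = μ-side} {μ-side} {i} {i'} eq =
  ⊥-elim (even≢odd (suc (toℕ i)) (toℕ i')
           (trans (sym (suc[2*x+1]≡2*suc[x] (toℕ i))) (trans eq (+-comm (2 * toℕ i') 1))))

rowIndex-injective : ∀ {n s s'} {i i' : Fin n} → rowIndex s i ≡ rowIndex s' i' → s ≡ s' × i ≡ i'
rowIndex-injective {s = μ-side} {μ-side} eq =
  refl , toℕ-injective (*-cancelˡ-≡ _ _ 2 (+-cancelʳ-≡ 1 _ _ eq))
rowIndex-injective {s = ν-side} {ν-side} eq = refl , toℕ-injective (*-cancelˡ-≡ _ _ 2 eq)
rowIndex-injective {s = μ-side} {ν-side} {i} {i'} eq =
  ⊥-elim (even≢odd (toℕ i') (toℕ i) (trans (sym eq) (+-comm (2 * toℕ i) 1)))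
rowIndex-injective {s = ν-side} {μ-side} {i} {i'} eq =
  ⊥-elim (even≢odd (toℕ i) (toℕ i') (trans eq (+-comm (2 * toℕ i') 1)))

-- Fixed points of * are the interlacing pairs

module _ {n} {μ ν : Tuple n} (μ-partition : IsPartition μ) (ν-partition : IsPartition ν) where

  interlaced⇒shifted-≤ : Interlaced (μ , ν) → ∀ {j k} → toℕ j ≤ toℕ k →
                         shifted μ k ℤ.≤ shifted ν j
  interlaced⇒shifted-≤ inter {j} {k} j≤k =
    from (shifted-≤⇔ μ ν k j) (+-mono-≤ (≤-trans (inter ν-below-μ) (ν-partition j k j≤k)) j≤k)

  interlaced⇒shifted-< : Interlaced (μ , ν) → ∀ {j k} → toℕ k < toℕ j →
                         shifted ν j ℤ.< shifted μ k
  interlaced⇒shifted-< inter {j} {k} k<j =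
    from (shifted-<⇔ μ ν k j)
         (+-mono-≤-< (≤-trans (ν-partition k⁺ j k⁺≤j) (inter (μ-below-ν k⁺≡1+k))) k<j)
    where
    k⁺ : Fin n
    k⁺ = fromℕ< (≤-<-trans k<j (toℕ<n j))
    k⁺≡1+k : toℕ k⁺ ≡ suc (toℕ k)
    k⁺≡1+k = toℕ-fromℕ< _
    k⁺≤j : toℕ k⁺ ≤ toℕ j
    k⁺≤j = subst (_≤ toℕ j) (sym k⁺≡1+k) k<j

  interlaced⇒starFixed : Interlaced (μ , ν) → StarFixed (μ , ν)
  interlaced⇒starFixed inter = fixλ , fixρ
    where
    fixλ : ∀ k → starλ μ ν k ≡ + μ k
    fixλ k = from (starλ≡⇔count≡ μ ν k) (count-≡ _ (toℕ<n k)
      (λ j Pj → s≤s (≮⇒≥ λ k<j → ℤ.<⇒≱ (interlaced⇒shifted-< inter k<j) Pj))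
      (λ j j≤k → interlaced⇒shifted-≤ inter (≤-pred j≤k)))
    fixρ : ∀ j → starρ μ ν j ≡ + ν j
    fixρ j = from (starρ≡⇔count≡ μ ν j) (count-≡ _ (<⇒≤ (toℕ<n j))
      (λ k Qk → ≰⇒> λ j≤k → ℤ.<⇒≱ Qk (interlaced⇒shifted-≤ inter j≤k))
      (λ k k<j → interlaced⇒shifted-< inter k<j))

  starFixed⇒interlaced : StarFixed (μ , ν) → Interlaced (μ , ν)
  starFixed⇒interlaced (fixλ , _) (ν-below-μ {i}) = ≮⇒≥ λ ν<μ →
    1+n≰n (subst (_≤ toℕ i) (to (starλ≡⇔count≡ μ ν i) (fixλ i)) (count-≤ _ (counted-below ν<μ)))
    where
    counted-below : ν i < μ i → ∀ j → shifted μ i ℤ.≤ shifted ν j → toℕ j < toℕ i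
    counted-below ν<μ j counted = ≰⇒> λ i≤j →
      <⇒≱ (+-mono-<-≤ (≤-<-trans (ν-partition i j i≤j) ν<μ) i≤j) (to (shifted-≤⇔ μ ν i j) counted)
  starFixed⇒interlaced (_ , fixρ) (μ-below-ν {i} {i'} i'≡1+i) = ≮⇒≥ λ μ<ν →
    1+n≰n (subst (_≤ toℕ i) (trans (to (starρ≡⇔count≡ μ ν i') (fixρ i')) i'≡1+i)
                 (count-≤ _ (counted-below μ<ν)))
    where
    counted-below : μ i < ν i' → ∀ k → shifted ν i' ℤ.< shifted μ k → toℕ k < toℕ i
    counted-below μ<ν k counted = ≰⇒> λ i≤k →
      <⇒≱ (to (shifted-<⇔ μ ν k i') counted)
          (subst (_≤ ν i' + toℕ k) (sym (trans (cong (λ x → μ k + x) i'≡1+i) (+-suc (μ k) (toℕ i))))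
                 (+-mono-<-≤ (≤-<-trans (μ-partition i k i≤k) μ<ν) i≤k))

  starFixed⇔interlaced : StarFixed (μ , ν) ⇔ Interlaced (μ , ν)
  starFixed⇔interlaced = mk⇔ starFixed⇒interlaced interlaced⇒starFixed

module _ {n} {p q : Tuple n} where

  addCell-≤ : AddCell p q → ∀ i → p i ≤ q i
  addCell-≤ (r , q≡1+p , others) i with i Fin.≟ r
  ... | yes refl = subst (p i ≤_) (sym q≡1+p) (n≤1+n (p i))
  ... | no i≢r = ≤-reflexive (sym (others i i≢r))

  addCell-row : (add : AddCell p q) → ∀ {i} → p i < q i → i ≡ proj₁ add
  addCell-row (r , _ , others) {i} grows with i Fin.≟ r
  ... | yes i≡r = i≡r
  ... | no i≢r = ⊥-elim (<-irrefl (sym (others i i≢r)) grows)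

  addCell-suc : AddCell p q → ∀ {i} → p i < q i → q i ≡ suc (p i)
  addCell-suc add@(_ , q≡1+p , _) grows with addCell-row add grows
  ... | refl = q≡1+p

  sameTuple-≤ : SameTuple p q → ∀ i → p i ≤ q i
  sameTuple-≤ same i = ≤-reflexive (sym (same i))

  sameTuple-≮ : SameTuple p q → ∀ {i} → p i ≮ q i
  sameTuple-≮ same {i} = <-irrefl (sym (same i))

module _ {n} {p q : Pair n} where

  cover-≤ : Cover p q → ∀ s i → part s p i ≤ part s q i
  cover-≤ (inj₁ (add , _))  μ-side = addCell-≤ add
  cover-≤ (inj₁ (_ , same)) ν-side = sameTuple-≤ same
  cover-≤ (inj₂ (same , _)) μ-side = sameTuple-≤ same
  cover-≤ (inj₂ (_ , add))  ν-side = addCell-≤ add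

  cover-suc : Cover p q → ∀ s {i} → part s p i < part s q i → part s q i ≡ suc (part s p i)
  cover-suc (inj₁ (add , _))  μ-side grows = addCell-suc add grows
  cover-suc (inj₁ (_ , same)) ν-side grows = ⊥-elim (sameTuple-≮ same grows)
  cover-suc (inj₂ (same , _)) μ-side grows = ⊥-elim (sameTuple-≮ same grows)
  cover-suc (inj₂ (_ , add))  ν-side grows = addCell-suc add grows

  cover-unique : Cover p q → ∀ s s' {i i'} → part s p i < part s q i → part s' p i' < part s' q i' →
                 s ≡ s' × i ≡ i'
  cover-unique (inj₁ (add , _))  μ-side μ-side grows grows' =
    refl , trans (addCell-row add grows) (sym (addCell-row add grows'))
  cover-unique (inj₂ (_ , add))  ν-side ν-side grows grows' =
    refl , trans (addCell-row add grows) (sym (addCell-row add grows'))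
  cover-unique (inj₁ (_ , same)) ν-side _      grows _      = ⊥-elim (sameTuple-≮ same grows)
  cover-unique (inj₁ (_ , same)) μ-side ν-side _     grows' = ⊥-elim (sameTuple-≮ same grows')
  cover-unique (inj₂ (same , _)) μ-side _      grows _      = ⊥-elim (sameTuple-≮ same grows)
  cover-unique (inj₂ (same , _)) ν-side μ-side _     grows' = ⊥-elim (sameTuple-≮ same grows')

-- A standard pair as a filling of T

module Chain {n μ ν N π} (SP : StandardPair n μ ν N π) where
  open StandardPair SP
  open Filling (tableauT μ ν π N)

  len : Side → ℕ → Fin n → ℕ
  len s m = part s (π m)

  len-start : ∀ s i → len s 0 i ≡ 0
  len-start μ-side = proj₁ start
  len-start ν-side = proj₂ start

  len-final : ∀ s i → len s N i ≡ part s (μ , ν) i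
  len-final μ-side = proj₁ end
  len-final ν-side = proj₂ end

  len-isPartition : ∀ s m → m ≤ N → IsPartition (len s m)
  len-isPartition μ-side m m≤N = proj₁ (partitions m m≤N)
  len-isPartition ν-side m m≤N = proj₂ (partitions m m≤N)

  shape-isPartition : ∀ s → IsPartition (part s (μ , ν))
  shape-isPartition s i j i≤j =
    subst₂ _≤_ (len-final s j) (len-final s i) (len-isPartition s N ≤-refl i j i≤j)

  interlaced-shape⇔final : Interlaced (μ , ν) ⇔ Interlaced (π N)
  interlaced-shape⇔final = mk⇔
    (λ inter {s} {i} {s'} {i'} below →
       subst₂ _≤_ (sym (len-final s' i')) (sym (len-final s i)) (inter below))
    (λ inter {s} {i} {s'} {i'} below →
       subst₂ _≤_ (len-final s' i') (len-final s i) (inter below))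

  len-mono : ∀ s {m m'} → m ≤ m' → m' ≤ N → ∀ i → len s m i ≤ len s m' i
  len-mono s m≤m' = stepwise (≤⇒≤′ m≤m')
    where
    stepwise : ∀ {m m'} → m ≤′ m' → m' ≤ N → ∀ i → len s m i ≤ len s m' i
    stepwise ≤′-refl          _    i = ≤-refl
    stepwise (≤′-step m≤m') m'<N i =
      ≤-trans (stepwise m≤m' (<⇒≤ m'<N) i) (cover-≤ (covers _ m'<N) s i)

  -- tEntry (μ-side) and rEntry (ν-side) of the pair, as one record indexed by the side
  record Filled (s : Side) (i : Fin n) (c e : ℕ) : Set where
    constructor filled
    field
      1≤e     : 1 ≤ e
      e≤N     : e ≤ N
      added   : c < len s e i
      missing : len s (e ∸ 1) i ≤ c

  filled-column : ∀ {s i c e} → Filled s i c e → c ≡ len s (e ∸ 1) i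
  filled-column {e = zero} (filled () _ _ _)
  filled-column {s} {e = suc m} (filled _ m<N c<len len≤c) =
    ≤-antisym (≤-pred (subst (_ <_) (cover-suc (covers m m<N) s (≤-<-trans len≤c c<len)) c<len))
              len≤c

  filled-injective : ∀ {s s' i i' c c' e} → Filled s i c e → Filled s' i' c' e →
                     s ≡ s' × i ≡ i' × c ≡ c'
  filled-injective {e = zero} (filled () _ _ _) _
  filled-injective {s} {s'} {e = suc m} f@(filled _ m<N c<len len≤c) f'@(filled _ _ c'<len len≤c')
    with cover-unique (covers m m<N) s s' (≤-<-trans len≤c c<len) (≤-<-trans len≤c' c'<len)
  ... | refl , refl = refl , refl , trans (filled-column f) (sym (filled-column f'))

  filled-≤ : ∀ {s i c e m} → Filled s i c e → c < len s m i → e ≤ m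
  filled-≤ {e = zero} (filled () _ _ _) _
  filled-≤ {s} {i} {e = suc k} (filled _ k<N _ len≤c) c<len = ≮⇒≥ λ where
    (s≤s m≤k) → <⇒≱ c<len (≤-trans (len-mono s m≤k (<⇒≤ k<N) i) len≤c)

  filled-inside : ∀ {s i c e m} → Filled s i c e → e ≤ m → m ≤ N → c < len s m i
  filled-inside {s} {i} (filled _ _ c<len _) e≤m m≤N = <-≤-trans c<len (len-mono s e≤m m≤N i)

  filled-exists : ∀ {s i c} m → m ≤ N → c < len s m i → Σ ℕ (Filled s i c)
  filled-exists {s} {i} zero _ c<len = ⊥-elim (n≮0 (subst (_ <_) (len-start s i) c<len))
  filled-exists {s} {i} {c} (suc m) m<N c<len with c <? len s m i
  ... | yes earlier = filled-exists m (<⇒≤ m<N) earlier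
  ... | no later    = suc m , filled (s≤s z≤n) m<N c<len (≮⇒≥ later)

  filled-rowIncreasing : ∀ {s i c c' e e'} → Filled s i c e → Filled s i c' e' → c < c' → e < e'
  filled-rowIncreasing f f'@(filled _ _ c'<len _) c<c' =
    ≤∧≢⇒< (filled-≤ f (<-trans c<c' c'<len))
          λ { refl → <-irrefl (proj₂ (proj₂ (filled-injective f f'))) c<c' }

  filled-colIncreasing : ∀ {s s' i i' c e e'} → Interlaced (π e') → RowBelow s i s' i' →
                         Filled s i c e → Filled s' i' c e' → e < e'
  filled-colIncreasing inter below f f'@(filled _ _ c<len _) =
    ≤∧≢⇒< (filled-≤ f (<-≤-trans c<len (inter below)))
          λ { refl → RowBelow⇒≢ below (proj₁ (filled-injective f f')) }

  filled⇒Entry : ∀ {s i c e} → Filled s i c e → Entry (rowIndex s i) c e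
  filled⇒Entry {μ-side} {i} (filled 1≤e e≤N added missing) =
    i , inj₂ (refl , 1≤e , e≤N , added , missing)
  filled⇒Entry {ν-side} {i} (filled 1≤e e≤N added missing) =
    i , inj₁ (refl , 1≤e , e≤N , added , missing)

  Entry⇒filled : ∀ {a c e} → Entry a c e →
                 Σ Side λ s → Σ (Fin n) λ i → (a ≡ rowIndex s i) × Filled s i c e
  Entry⇒filled (i , inj₁ (a≡ , 1≤e , e≤N , added , missing)) =
    ν-side , i , a≡ , filled 1≤e e≤N added missing
  Entry⇒filled (i , inj₂ (a≡ , 1≤e , e≤N , added , missing)) =
    μ-side , i , a≡ , filled 1≤e e≤N added missing

  inShape : ∀ {s i c} → c < len s N i → InShape (rowIndex s i) c
  inShape {μ-side} {i} c<len = i , inj₂ (refl , subst (_ <_) (len-final μ-side i) c<len)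
  inShape {ν-side} {i} c<len = i , inj₁ (refl , subst (_ <_) (len-final ν-side i) c<len)

  interlaced⇒standard : (∀ m → m ≤ N → Interlaced (π m)) → StandardTableau (tableauT μ ν π N)
  interlaced⇒standard inter = record { distinct = distinct ; rowInc = rowInc ; colInc = colInc }
    where
    distinct : ∀ a c a' c' e → Entry a c e → Entry a' c' e → (a ≡ a') × (c ≡ c')
    distinct _ _ _ _ _ x x' with Entry⇒filled x | Entry⇒filled x'
    ... | s , i , refl , f | s' , i' , refl , f' with filled-injective {s} {s'} {i} {i'} f f'
    ...   | refl , refl , refl = refl , refl

    rowInc : ∀ a c c' e e' → c < c' → InShape a c → InShape a c' →
             Entry a c e → Entry a c' e' → e < e'
    rowInc _ _ _ _ _ c<c' _ _ x x' with Entry⇒filled x | Entry⇒filled x'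
    ... | s , i , refl , f | s' , i' , a≡ , f' with rowIndex-injective {s = s} {s'} {i} {i'} a≡
    ...   | refl , refl = filled-rowIncreasing f f' c<c'

    colInc : ∀ a c e e' → InShape a c → InShape (suc a) c →
             Entry a c e → Entry (suc a) c e' → e < e'
    colInc _ _ _ _ _ _ x x' with Entry⇒filled x | Entry⇒filled x'
    ... | _ , _ , refl , f | _ , _ , a≡ , f'@(filled _ e'≤N _ _) =
      filled-colIncreasing (inter _ e'≤N) (suc-rowIndex⇒RowBelow a≡) f f'

  standard⇒downClosed : ∀ {s s' i i' c m} → StandardTableau (tableauT μ ν π N) →
                        RowBelow s i s' i' → m ≤ N →
                        c < len s N i → c < len s' m i' → c < len s m i
  standard⇒downClosed {s} {s'} {i} {i'} {c} {m} standard below m≤N lower upper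
    with filled-exists {s} {i} N ≤-refl lower | filled-exists {s'} {i'} m m≤N upper
  ... | e , f | e' , f' = filled-inside f (≤-trans (<⇒≤ e<e') (filled-≤ f' upper)) m≤N
    where
    rows : suc (rowIndex s i) ≡ rowIndex s' i'
    rows = RowBelow⇒suc-rowIndex below
    e<e' : e < e'
    e<e' = StandardTableau.colInc standard (rowIndex s i) c e e'
             (inShape {s} {i} lower)
             (subst (λ a → InShape a c) (sym rows)
                    (inShape {s'} {i'} (<-≤-trans upper (len-mono s' m≤N ≤-refl i'))))
             (filled⇒Entry f)
             (subst (λ a → Entry a c e') (sym rows) (filled⇒Entry f'))

  standard⇒interlaced : Interlaced (π N) → StandardTableau (tableauT μ ν π N) →
                        ∀ m → m ≤ N → Interlaced (π m)
  standard⇒interlaced final standard m m≤N {s} {i} {s'} {i'} below = ≮⇒≥ λ longer →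
    <-irrefl refl (standard⇒downClosed {m = m} standard below m≤N
                    (<-≤-trans longer (≤-trans (len-mono s' m≤N ≤-refl i') (final below))) longer)

lemma5p2 : (n : ℕ) (μ ν : Tuple n) (N : ℕ) (π : ℕ → Pair n) →
           StandardPair n μ ν N π →
           ((∀ m → m ≤ N → StarFixed (π m))
             ⇔ (StarFixed (μ , ν) × StandardTableau (tableauT μ ν π N)))
lemma5p2 n μ ν N π SP = mk⇔ chain-fixed⇒ chain-fixed⇐
  where
  open Chain SP

  fixed⇔interlaced : ∀ m → m ≤ N → StarFixed (π m) ⇔ Interlaced (π m)
  fixed⇔interlaced m m≤N =
    starFixed⇔interlaced (len-isPartition μ-side m m≤N) (len-isPartition ν-side m m≤N)

  shape-fixed⇔interlaced : StarFixed (μ , ν) ⇔ Interlaced (π N)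
  shape-fixed⇔interlaced =
    ⇔-trans (starFixed⇔interlaced (shape-isPartition μ-side) (shape-isPartition ν-side))
            interlaced-shape⇔final

  chain-fixed⇒ : (∀ m → m ≤ N → StarFixed (π m)) →
                 StarFixed (μ , ν) × StandardTableau (tableauT μ ν π N)
  chain-fixed⇒ fixed =
    from shape-fixed⇔interlaced (interlaced N ≤-refl) , interlaced⇒standard interlaced
    where
    interlaced : ∀ m → m ≤ N → Interlaced (π m)
    interlaced m m≤N = to (fixed⇔interlaced m m≤N) (fixed m m≤N)

  chain-fixed⇐ : StarFixed (μ , ν) × StandardTableau (tableauT μ ν π N) →
                 ∀ m → m ≤ N → StarFixed (π m)
  chain-fixed⇐ (shape-fixed , standard) m m≤N = from (fixed⇔interlaced m m≤N)
    (standard⇒interlaced (to shape-fixed⇔interlaced shape-fixed) standard m m≤N)
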